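{- Let $p$ be an odd prime, $d$ a positive integer with $p\nmid d$, and $j$ an integer with $(p+1)/2\le j\le p-2$. Then $L_j(\{d\})\ge L_{j+1}(\{d\})$.
   Context: For an integer $0\le j\le p-1$ and a positive integer $d$ with $p\nmid d$, $$L_j(\{d\})=\sum_{i=j}^{p-1}\left(\left\lfloor\frac{id}{p}\right\rfloor-\left\lfloor \frac{id}{p}-\left(1-\frac1p\right)\frac{jd}{p}\right\rfloor\right).$$ -}

module Defs where

open import Data.Nat as ℕ using (ℕ; zero; suc; _∸_)
open import Data.Integer as ℤ using (ℤ; +_; _-_; _/ℕ_; 0ℤ)
open import Data.List using (List; map; foldr; applyUpTo)

-- floor (a / n) for an integer a and a natural n (n = 0 never used: n is a
-- power of the prime p). For n > 0, stdlib's _/ℕ_ is floor division.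
⌊_/_⌋ : ℤ → ℕ → ℤ
⌊ a / zero ⌋  = 0ℤ
⌊ a / suc n ⌋ = a /ℕ suc n

sumFromTo : ℕ → ℕ → (ℕ → ℤ) → ℤ
sumFromTo a b f = foldr ℤ._+_ 0ℤ (map f (applyUpTo (a ℕ.+_) (b ∸ a)))

-- The summand  ⌊ i d / p ⌋ - ⌊ i d / p - (1 - 1/p) j d / p ⌋,
-- where  i d / p - (1 - 1/p) j d / p = (i d p - (p - 1) j d) / p².
Lterm : (p j d i : ℕ) → ℤ
Lterm p j d i =
  ⌊ + (i ℕ.* d) / p ⌋
  - ⌊ (+ (i ℕ.* d ℕ.* p) - + ((p ∸ 1) ℕ.* j ℕ.* d)) / (p ℕ.* p) ⌋

L : (p j d : ℕ) → ℤ
L p j d = sumFromTo j p (Lterm p j d)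

module Submission where

-- Write p = n + 1 and, for J ≤ i,
--   u i   = ⌊ i d / p ⌋,
--   α J i = ⌊ (i d p - (p - 1) J d) / p² ⌋   (the numerator is then ≥ 0),
-- so that the summand of L_J is  u i - α J i  and
--   L_J = Σ_{i=J}^{p-1} u i  -  Σ_{i=J}^{p-1} α J i.
-- Comparing L_j with L_{j+1}, the u-sums differ only by the term u j.  For the
-- α-sums we pair α j i with α (j+1) (i+1): raising both J and i by one adds
-- d p - (p - 1) d ≥ 0 to the numerator, so α j i ≤ α (j+1) (i+1).  Hence
--   Σ_{i=j}^{p-1} α j i ≤ Σ_{i=j+1}^{p-1} α (j+1) i + α j (p-1),
-- and the unmatched last term satisfies α j (p-1) ≤ u j as soon as 2j ≥ p + 1.
-- Together these give L_{j+1} ≤ L_j.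

open import Defs
open import Data.Nat using (ℕ; _+_; _*_; _∸_; _≤_; _<_)
open import Data.Nat.Divisibility using (_∣_)
open import Data.Nat.Primality using (Prime)
open import Data.Integer as ℤ using ()
open import Relation.Nullary using (¬_)
open import Relation.Binary.PropositionalEquality using (_≢_)

open import Data.Nat using (zero; suc; _/_)
import Data.Nat.Properties as ℕₚ
open import Data.Nat.DivMod using (/-monoˡ-≤; m*n/m*o≡n/o)
open import Data.Integer using (ℤ; +_; 0ℤ; +≤+)
import Data.Integer.Properties as ℤₚ
open import Data.List using (map; foldr; applyUpTo)
open import Function using (_∘_)
open import Relation.Binary.PropositionalEquality
  using (_≡_; refl; sym; trans; cong; cong₂; subst; module ≡-Reasoning)
import Data.Nat.Solver as ℕSolver
import Data.Integer.Solver as ℤSolver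

Σ : ℕ → (ℕ → ℤ) → ℤ
Σ zero    f = 0ℤ
Σ (suc n) f = f 0 ℤ.+ Σ n (f ∘ suc)

sumFromTo≡Σ : ∀ a b f → sumFromTo a b f ≡ Σ (b ∸ a) (λ k → f (a + k))
sumFromTo≡Σ a b f = foldr-applyUpTo (λ k → a + k) (b ∸ a)
  where
  foldr-applyUpTo : ∀ g n → foldr ℤ._+_ 0ℤ (map f (applyUpTo g n)) ≡ Σ n (f ∘ g)
  foldr-applyUpTo g zero    = refl
  foldr-applyUpTo g (suc n) = cong (λ s → f (g 0) ℤ.+ s) (foldr-applyUpTo (g ∘ suc) n)

Σ-cong : ∀ {f g} n → (∀ k → f k ≡ g k) → Σ n f ≡ Σ n g
Σ-cong zero    f≡g = refl
Σ-cong (suc n) f≡g = cong₂ ℤ._+_ (f≡g 0) (Σ-cong n (f≡g ∘ suc))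

Σ-mono-≤ : ∀ {f g} n → (∀ k → f k ℤ.≤ g k) → Σ n f ℤ.≤ Σ n g
Σ-mono-≤ zero    f≤g = ℤₚ.≤-refl
Σ-mono-≤ (suc n) f≤g = ℤₚ.+-mono-≤ (f≤g 0) (Σ-mono-≤ n (f≤g ∘ suc))

Σ-snoc : ∀ n f → Σ (suc n) f ≡ Σ n f ℤ.+ f n
Σ-snoc zero    f = trans (ℤₚ.+-identityʳ (f 0)) (sym (ℤₚ.+-identityˡ (f 0)))
Σ-snoc (suc n) f = trans (cong (λ s → f 0 ℤ.+ s) (Σ-snoc n (f ∘ suc)))
                         (sym (ℤₚ.+-assoc (f 0) (Σ n (f ∘ suc)) (f (suc n))))

Σ-sub : ∀ n f g → Σ n (λ k → f k ℤ.- g k) ≡ Σ n f ℤ.- Σ n g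
Σ-sub zero    f g = refl
Σ-sub (suc n) f g = trans (cong (λ s → f 0 ℤ.- g 0 ℤ.+ s) (Σ-sub n (f ∘ suc) (g ∘ suc)))
                          (regroup (f 0) (g 0) (Σ n (f ∘ suc)) (Σ n (g ∘ suc)))
  where
  open ℤSolver.+-*-Solver
  regroup : ∀ a b x y → (a ℤ.- b) ℤ.+ (x ℤ.- y) ≡ (a ℤ.+ x) ℤ.- (b ℤ.+ y)
  regroup = solve 4 (λ a b x y → (a :- b) :+ (x :- y) := (a :+ x) :- (b :+ y)) refl

sub-sub-≤ : ∀ x {a b c s} → s ℤ.≤ b → a ℤ.≤ c → x ℤ.- b ℤ.≤ (c ℤ.+ x) ℤ.- (s ℤ.+ a)
sub-sub-≤ x {a} {b} {c} {s} s≤b a≤c = begin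
  x ℤ.- b                      ≡⟨ pad x b c ⟩
  (c ℤ.+ x) ℤ.- (b ℤ.+ c)      ≤⟨ ℤₚ.+-monoʳ-≤ (c ℤ.+ x) (ℤₚ.neg-mono-≤ (ℤₚ.+-mono-≤ s≤b a≤c)) ⟩
  (c ℤ.+ x) ℤ.- (s ℤ.+ a)      ∎
  where
  open ℤₚ.≤-Reasoning
  open ℤSolver.+-*-Solver
  pad : ∀ x b c → x ℤ.- b ≡ (c ℤ.+ x) ℤ.- (b ℤ.+ c)
  pad = solve 3 (λ x b c → x :- b := (c :+ x) :- (b :+ c)) refl

∸-shift-≤ : ∀ x y {a b} → b ≤ a → x ∸ y ≤ (a + x) ∸ (b + y)
∸-shift-≤ x y {a} {b} b≤a = begin
  x ∸ y              ≡⟨ sym (ℕₚ.[m+n]∸[m+o]≡n∸o a x y) ⟩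
  (a + x) ∸ (a + y)  ≤⟨ ℕₚ.∸-monoʳ-≤ (a + x) (ℕₚ.+-monoˡ-≤ y b≤a) ⟩
  (a + x) ∸ (b + y)  ∎
  where open ℕₚ.≤-Reasoning

-- The elementary inequality behind the hypothesis 2j ≥ p + 1 (with p = n + 1):
-- (p - 1) p ≤ (p - 1) j + j p.
square-≤ : ∀ n j → suc n + 1 ≤ 2 * j → n * suc n ≤ n * j + j * suc n
square-≤ n j p+1≤2j = ℕₚ.*-cancelˡ-≤ 2 (begin
  2 * (n * suc n)                      ≤⟨ ℕₚ.m≤m+n (2 * (n * suc n)) (3 * n + 2) ⟩
  2 * (n * suc n) + (3 * n + 2)        ≡⟨ expand n ⟩
  (suc n + 1) * (2 * n + 1)            ≤⟨ ℕₚ.*-monoˡ-≤ (2 * n + 1) p+1≤2j ⟩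
  2 * j * (2 * n + 1)                  ≡⟨ collect n j ⟩
  2 * (n * j + j * suc n)              ∎)
  where
  open ℕₚ.≤-Reasoning
  open ℕSolver.+-*-Solver
  expand : ∀ n → 2 * (n * suc n) + (3 * n + 2) ≡ (suc n + 1) * (2 * n + 1)
  expand = solve 1 (λ n → con 2 :* (n :* (con 1 :+ n)) :+ (con 3 :* n :+ con 2)
                          := ((con 1 :+ n) :+ con 1) :* (con 2 :* n :+ con 1)) refl
  collect : ∀ n j → 2 * j * (2 * n + 1) ≡ 2 * (n * j + j * suc n)
  collect = solve 2 (λ n j → con 2 :* j :* (con 2 :* n :+ con 1)
                             := con 2 :* (n :* j :+ j :* (con 1 :+ n))) refl

module _ (n d : ℕ) where

  private
    p : ℕ
    p = suc n

  u : ℕ → ℕ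
  u i = i * d / p

  -- α J i = ⌊ (i d p - (p - 1) J d) / p² ⌋  (meaningful for J ≤ i)
  α : ℕ → ℕ → ℕ
  α J i = (i * d * p ∸ n * J * d) / (p * p)

  -- For J ≤ i the numerator of the second floor in Lterm is non-negative, so
  -- the summand of L_J is a difference of two natural-number quotients.
  Lterm≡u-α : ∀ J i → J ≤ i → Lterm p J d i ≡ + u i ℤ.- + α J i
  Lterm≡u-α J i J≤i = cong (λ z → + u i ℤ.- ⌊ z / p * p ⌋) numerator
    where
    bound : n * J * d ≤ i * d * p
    bound = begin
      n * J * d   ≤⟨ ℕₚ.*-monoˡ-≤ d (ℕₚ.*-monoˡ-≤ J (ℕₚ.n≤1+n n)) ⟩
      p * J * d   ≤⟨ ℕₚ.*-monoˡ-≤ d (ℕₚ.*-monoʳ-≤ p J≤i) ⟩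
      p * i * d   ≡⟨ solve 3 (λ p i d → p :* i :* d := i :* d :* p) refl p i d ⟩
      i * d * p   ∎
      where
      open ℕₚ.≤-Reasoning
      open ℕSolver.+-*-Solver
    numerator : + (i * d * p) ℤ.- + (n * J * d) ≡ + (i * d * p ∸ n * J * d)
    numerator = trans (ℤₚ.m-n≡m⊖n (i * d * p) (n * J * d)) (ℤₚ.⊖-≥ bound)

  U A : ℕ → ℤ
  U J = Σ (p ∸ J) (λ k → + u (J + k))
  A J = Σ (p ∸ J) (λ k → + α J (J + k))

  L≡U-A : ∀ J → L p J d ≡ U J ℤ.- A J
  L≡U-A J = begin
    L p J d                                                ≡⟨ sumFromTo≡Σ J p (Lterm p J d) ⟩
    Σ (p ∸ J) (λ k → Lterm p J d (J + k))                  ≡⟨ Σ-cong (p ∸ J) (λ k → Lterm≡u-α J (J + k) (ℕₚ.m≤m+n J k)) ⟩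
    Σ (p ∸ J) (λ k → + u (J + k) ℤ.- + α J (J + k))        ≡⟨ Σ-sub (p ∸ J) _ _ ⟩
    U J ℤ.- A J                                            ∎
    where open ≡-Reasoning

  -- Raising J and i by one adds  d p - (p - 1) d ≥ 0  to the numerator of α.
  α-shift : ∀ J i → α J i ≤ α (suc J) (suc i)
  α-shift J i = /-monoˡ-≤ (p * p) (begin
    i * d * p ∸ n * J * d                          ≤⟨ ∸-shift-≤ (i * d * p) (n * J * d) nd≤dp ⟩
    (d * p + i * d * p) ∸ (n * d + n * J * d)      ≡⟨ cong₂ _∸_ (grow-i i) (grow-J J) ⟩
    suc i * d * p ∸ n * suc J * d                  ∎)
    where
    open ℕₚ.≤-Reasoning
    open ℕSolver.+-*-Solver
    nd≤dp : n * d ≤ d * p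
    nd≤dp = ℕₚ.≤-trans (ℕₚ.*-monoˡ-≤ d (ℕₚ.n≤1+n n)) (ℕₚ.≤-reflexive (ℕₚ.*-comm p d))
    grow-i : ∀ i → d * p + i * d * p ≡ suc i * d * p
    grow-i i = solve 3 (λ i d p → d :* p :+ i :* d :* p := (con 1 :+ i) :* d :* p) refl i d p
    grow-J : ∀ J → n * d + n * J * d ≡ n * suc J * d
    grow-J J = solve 3 (λ J n d → n :* d :+ n :* J :* d := n :* (con 1 :+ J) :* d) refl J n d

  α-last≤u : ∀ j → p + 1 ≤ 2 * j → α j n ≤ u j
  α-last≤u j p+1≤2j = begin
    (n * d * p ∸ n * j * d) / (p * p)   ≤⟨ /-monoˡ-≤ (p * p) (ℕₚ.m≤n+o⇒m∸n≤o (n * d * p) (n * j * d) numerator-≤) ⟩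
    j * d * p / (p * p)                 ≡⟨ cong (_/ (p * p)) (ℕₚ.*-comm (j * d) p) ⟩
    p * (j * d) / (p * p)               ≡⟨ m*n/m*o≡n/o p (j * d) p ⟩
    j * d / p                           ∎
    where
    open ℕₚ.≤-Reasoning
    open ℕSolver.+-*-Solver
    numerator-≤ : n * d * p ≤ n * j * d + j * d * p
    numerator-≤ = begin
      n * d * p                ≡⟨ solve 3 (λ n d p → n :* d :* p := n :* p :* d) refl n d p ⟩
      n * p * d                ≤⟨ ℕₚ.*-monoˡ-≤ d (square-≤ n j p+1≤2j) ⟩
      (n * j + j * p) * d      ≡⟨ solve 4 (λ n j p d → (n :* j :+ j :* p) :* d
                                                      := n :* j :* d :+ j :* d :* p) refl n j p d ⟩
      n * j * d + j * d * p    ∎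

  L-antitone : ∀ j → p + 1 ≤ 2 * j → j ≤ n → L p (suc j) d ℤ.≤ L p j d
  L-antitone j p+1≤2j j≤n = begin
    L p (suc j) d                                  ≡⟨ L≡U-A (suc j) ⟩
    U (suc j) ℤ.- A (suc j)                        ≤⟨ sub-sub-≤ (U (suc j)) matched unmatched ⟩
    (+ u j ℤ.+ U (suc j)) ℤ.- (Σ r αⱼ ℤ.+ αⱼ r)    ≡⟨ cong₂ ℤ._-_ (sym U-split) (sym A-split) ⟩
    U j ℤ.- A j                                    ≡⟨ L≡U-A j ⟨
    L p j d                                        ∎
    where
    open ℤₚ.≤-Reasoning
    -- L_{j+1} has r = p - (j+1) terms, L_j one more.
    r : ℕ
    r = n ∸ j
    p∸j≡1+r : p ∸ j ≡ suc r
    p∸j≡1+r = ℕₚ.+-∸-assoc 1 j≤n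
    αⱼ : ℕ → ℤ
    αⱼ k = + α j (j + k)
    U-split : U j ≡ + u j ℤ.+ U (suc j)
    U-split = trans (cong (λ m → Σ m (λ k → + u (j + k))) p∸j≡1+r)
                (cong₂ ℤ._+_ (cong (+_ ∘ u) (ℕₚ.+-identityʳ j))
                             (Σ-cong r (λ k → cong (+_ ∘ u) (ℕₚ.+-suc j k))))
    A-split : A j ≡ Σ r αⱼ ℤ.+ αⱼ r
    A-split = trans (cong (λ m → Σ m αⱼ) p∸j≡1+r) (Σ-snoc r αⱼ)
    matched : Σ r αⱼ ℤ.≤ A (suc j)
    matched = Σ-mono-≤ r (λ k → +≤+ (α-shift j (j + k)))
    unmatched : αⱼ r ℤ.≤ + u j
    unmatched = +≤+ (subst (λ i → α j i ≤ u j) (sym (ℕₚ.m+[n∸m]≡n j≤n)) (α-last≤u j p+1≤2j))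

lemma2p11 : (p d j : ℕ) → Prime p → p ≢ 2 → 0 < d → ¬ (p ∣ d) →
            p + 1 ≤ 2 * j → j ≤ p ∸ 2 →
            L p (j + 1) d ℤ.≤ L p j d
lemma2p11 zero    d zero    _ _ _ _ () _
lemma2p11 zero    d (suc j) _ _ _ _ _  ()
lemma2p11 (suc n) d j       _ _ _ _ p+1≤2j j≤p-2 =
  subst (λ J → L (suc n) J d ℤ.≤ L (suc n) j d) (ℕₚ.+-comm 1 j)
        (L-antitone n d j p+1≤2j (ℕₚ.≤-trans j≤p-2 (ℕₚ.m∸n≤m n 1)))
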